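{- For every $n$ and every edge type $x \in \{1,\dots,\lfloor n/2\rfloor\}$ there exist two paths $Q_x$ and $Q_x'$ in $K_n$ such that $Q_x \cup Q_x'$ contains every $x$-type edge of $K_n$, and every edge of $Q_x \cup Q_x'$ has type $1$ or type $x$.
   Context: Label the vertices of $K_n$ by $1,\dots,n$, identified with residues modulo $n$ and arranged clockwise on a regular polygon. The type of an edge $\{u,v\}$ is $\min(|u-v|, n-|u-v|) \in \{1,\dots,\lfloor n/2\rfloor\}$; an edge of type $x$ is called an $x$-type edge. Paths are viewed as their edge sets. -}

module Defs where

open import Data.Nat using (ℕ; _∸_; _⊓_)
open import Data.Nat.Properties using ()
open import Data.Fin using (Fin; toℕ)
open import Data.List using (List; []; _∷_)
open import Data.List.Relation.Unary.Unique.Propositional using (Unique)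
open import Data.Product using (_×_; Σ; _,_)
open import Data.Sum using (_⊎_)
open import Relation.Binary.PropositionalEquality using (_≡_)

-- Vertices of K_n are Fin n (vertex i+1 of the paper is i; residues mod n).
-- Absolute difference |u - v| of the labels.
absDiff : ℕ → ℕ → ℕ
absDiff a b = (a ∸ b) Data.Nat.+ (b ∸ a)

edgeType : (n : ℕ) → Fin n → Fin n → ℕ
edgeType n u v = absDiff (toℕ u) (toℕ v) ⊓ (n ∸ absDiff (toℕ u) (toℕ v))

record Path (n : ℕ) : Set where
  constructor mkPath
  field
    verts  : List (Fin n)
    unique : Unique verts

data Consec {A : Set} (u v : A) : List A → Set where
  here  : ∀ {xs} → Consec u v (u ∷ v ∷ xs)
  there : ∀ {w xs} → Consec u v xs → Consec u v (w ∷ xs)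

EdgeOf : ∀ {n} → Fin n → Fin n → Path n → Set
EdgeOf u v P = Consec u v (Path.verts P) ⊎ Consec v u (Path.verts P)

{-# OPTIONS --safe #-}
-- Write n = ρ + (p + 1) x with ρ = n mod x; then p ≥ 1 because 2x ≤ n. On the vertices
-- 0, …, n − 1 the x-type edges are the pairs {a, x + a} with x + a < n, which lie inside the
-- residue classes mod x, and the wrap-around pairs {i, (n − x) + i} with i < x.
-- Q runs through the classes 0, …, x − 1 in turn, alternately up and down each class, and
-- steps to the next class along a 1-type edge. An up-then-down step needs both classes to
-- have the same height, which fails only between classes ρ − 1 and ρ; choosing the phase of
-- the alternation so that class ρ − 1 is traversed downwards avoids it.
-- Q′ = 0, n − x, n − x + 1, 1, 2, n − x + 2, … takes the wrap-around pairs as the rungs of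
-- a ladder.
module Submission where

open import Defs
open import Data.Empty using (⊥-elim)
open import Data.Fin using (Fin; toℕ; fromℕ<)
open import Data.Fin.Properties using (toℕ-fromℕ<; toℕ-injective; toℕ<n)
open import Data.List using (List; []; _∷_; _++_; map; concat; head; last; applyUpTo; applyDownFrom)
open import Data.List.Membership.Propositional using (_∈_)
open import Data.List.Membership.Propositional.Properties using (∈-applyUpTo⁺)
open import Data.List.Properties using (++-identityʳ)
open import Data.List.Relation.Binary.Disjoint.Propositional using (Disjoint)
open import Data.List.Relation.Unary.All as All using (All; []; _∷_)
import Data.List.Relation.Unary.All.Properties as All
import Data.List.Relation.Unary.AllPairs.Properties as AllPairs
open import Data.List.Relation.Unary.Any using (here; there)
open import Data.List.Relation.Unary.Linked using (Linked; []; [-]; _∷_)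
import Data.List.Relation.Unary.Linked.Properties as Linked
open import Data.List.Relation.Unary.Unique.Propositional using (Unique; []; _∷_)
import Data.List.Relation.Unary.Unique.Propositional.Properties as Unique
open import Data.Maybe using (just)
open import Data.Maybe.Relation.Binary.Connected using (Connected; just)
open import Data.Nat
  using (ℕ; zero; suc; parity; _+_; _*_; _∸_; _/_; _%_; _⊓_; _≤_; _<_; _<?_; z≤n; s≤s; s≤s⁻¹;
         NonZero; >-nonZero; >-nonZero⁻¹)
open import Data.Nat.DivMod
  using (m≡m%n+[m/n]*n; m%n<n; [m+kn]%n≡m%n; [m+n]%n≡m%n; m<n⇒m%n≡m; m/n*n≤m; m*n/n≡m; /-monoˡ-≤)
open import Data.Nat.Properties
open import Data.Parity.Base using (Parity; 0ℙ; 1ℙ; _⁻¹) renaming (_+_ to _ℙ+_)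
import Data.Parity.Properties as ℙ
open import Data.Product using (Σ; _×_; _,_)
open import Data.Sum using (_⊎_; inj₁; inj₂) renaming (map to ⊎-map; swap to ⊎-swap)
open import Function using (Injective; _∘_)
open import Relation.Binary.Core using (Rel)
open import Relation.Binary.Definitions using (Symmetric)
open import Relation.Binary.PropositionalEquality
  using (_≡_; _≢_; refl; sym; trans; cong; cong₂; subst; subst₂; module ≡-Reasoning)
open import Relation.Nullary using (yes; no)

module _ {A : Set} where

  Adjacent : A → A → List A → Set
  Adjacent u v xs = Consec u v xs ⊎ Consec v u xs

  Adjacent-sym : ∀ {u v : A} {xs} → Adjacent u v xs → Adjacent v u xs
  Adjacent-sym = ⊎-swap

  Consec-++ˡ : ∀ {u v : A} {xs} ys → Consec u v xs → Consec u v (xs ++ ys)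
  Consec-++ˡ ys here      = here
  Consec-++ˡ ys (there c) = there (Consec-++ˡ ys c)

  Consec-++ʳ : ∀ {u v : A} {ys} xs → Consec u v ys → Consec u v (xs ++ ys)
  Consec-++ʳ []       c = c
  Consec-++ʳ (_ ∷ xs) c = there (Consec-++ʳ xs c)

  Consec-concat : ∀ {u v : A} {xs xss} → Consec u v xs → xs ∈ xss → Consec u v (concat xss)
  Consec-concat c (here refl)          = Consec-++ˡ _ c
  Consec-concat c (there {ys} xs∈xss) = Consec-++ʳ ys (Consec-concat c xs∈xss)

  Adjacent-concat : ∀ {u v : A} {xs xss} → Adjacent u v xs → xs ∈ xss → Adjacent u v (concat xss)
  Adjacent-concat a xs∈xss = ⊎-map (λ c → Consec-concat c xs∈xss) (λ c → Consec-concat c xs∈xss) a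

  Consec-applyUpTo : ∀ (f : ℕ → A) {j k} → suc j < k → Consec (f j) (f (suc j)) (applyUpTo f k)
  Consec-applyUpTo f {zero}  {suc (suc k)} _           = here
  Consec-applyUpTo f {zero}  {suc zero}    (s≤s ())
  Consec-applyUpTo f {suc j} {suc k}       (s≤s sj<k) = there (Consec-applyUpTo (f ∘ suc) sj<k)

  Consec-applyDownFrom : ∀ (f : ℕ → A) {j k} → suc j < k → Consec (f (suc j)) (f j) (applyDownFrom f k)
  Consec-applyDownFrom f {j} {suc k} (s≤s sj≤k) with m≤n⇒m<n∨m≡n sj≤k
  ... | inj₁ sj<k = there (Consec-applyDownFrom f sj<k)
  ... | inj₂ refl = here

  last-applyUpTo : ∀ (f : ℕ → A) k → last (applyUpTo f (suc k)) ≡ just (f k)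
  last-applyUpTo f zero    = refl
  last-applyUpTo f (suc k) = last-applyUpTo (f ∘ suc) k

  last-applyDownFrom : ∀ (f : ℕ → A) k → last (applyDownFrom f (suc k)) ≡ just (f 0)
  last-applyDownFrom f zero    = refl
  last-applyDownFrom f (suc k) = last-applyDownFrom f k

  head-++ : ∀ {xs : List A} ys → xs ≢ [] → head (xs ++ ys) ≡ head xs
  head-++ {[]}    ys xs≢[] = ⊥-elim (xs≢[] refl)
  head-++ {_ ∷ _} ys _     = refl

  module _ {ℓ} {R : Rel A ℓ} where

    Linked-Consec : ∀ {u v : A} {xs} → Linked R xs → Consec u v xs → R u v
    Linked-Consec (r ∷ _) here      = r
    Linked-Consec (_ ∷ l) (there c) = Linked-Consec l c
    Linked-Consec [-]     (there ())

    Linked-Adjacent : Symmetric R → ∀ {u v : A} {xs} → Linked R xs → Adjacent u v xs → R u v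
    Linked-Adjacent R-sym l (inj₁ c) = Linked-Consec l c
    Linked-Adjacent R-sym l (inj₂ c) = R-sym (Linked-Consec l c)

    Linked-concat : ∀ {xss : List (List A)} → All (Linked R) xss → All (_≢ []) xss →
                    Linked (λ xs ys → Connected R (last xs) (head ys)) xss →
                    Linked R (concat xss)
    Linked-concat []       _                  []       = []
    Linked-concat (l ∷ []) _                  [-]      = subst (Linked R) (sym (++-identityʳ _)) l
    Linked-concat (l ∷ ls) (_ ∷ ne ∷ nes) (c ∷ cs) =
      Linked.++⁺ l (subst (Connected R _) (sym (head-++ _ ne)) c) (Linked-concat ls (ne ∷ nes) cs)

module _ {A B : Set} where

  Consec-map : ∀ (f : A → B) {u v xs} → Consec u v xs → Consec (f u) (f v) (map f xs)
  Consec-map f here      = here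
  Consec-map f (there c) = there (Consec-map f c)

  Consec-map⁻ : ∀ {f : A → B} → Injective _≡_ _≡_ f → ∀ {u v : A} {xs} →
                Consec (f u) (f v) (map f xs) → Consec u v xs
  Consec-map⁻ {f} f-inj {u} {v} c = go _ c refl refl
    where
    go : ∀ xs {a b} → Consec a b (map f xs) → f u ≡ a → f v ≡ b → Consec u v xs
    go (_ ∷ _ ∷ _) here fu≡ fv≡ =
      subst₂ (λ s t → Consec s t _) (sym (f-inj fu≡)) (sym (f-inj fv≡)) here
    go (_ ∷ xs) (there c) fu≡ fv≡ = there (go xs c fu≡ fv≡)

  Adjacent-map : ∀ (f : A → B) {u v xs} → Adjacent u v xs → Adjacent (f u) (f v) (map f xs)
  Adjacent-map f = ⊎-map (Consec-map f) (Consec-map f)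

  Adjacent-map⁻ : ∀ {f : A → B} → Injective _≡_ _≡_ f → ∀ {u v : A} {xs} →
                  Adjacent (f u) (f v) (map f xs) → Adjacent u v xs
  Adjacent-map⁻ f-inj = ⊎-map (Consec-map⁻ f-inj) (Consec-map⁻ f-inj)

Disjoint-byKey : ∀ {A B : Set} (key : A → B) {i j xs ys} →
                 All (λ v → key v ≡ i) xs → All (λ v → key v ≡ j) ys → i ≢ j → Disjoint xs ys
Disjoint-byKey key keys-xs keys-ys i≢j (v∈xs , v∈ys) =
  i≢j (trans (sym (All.lookup keys-xs v∈xs)) (All.lookup keys-ys v∈ys))

edgeTypeℕ : ℕ → ℕ → ℕ → ℕ
edgeTypeℕ n a b = absDiff a b ⊓ (n ∸ absDiff a b)

absDiff-comm : ∀ a b → absDiff a b ≡ absDiff b a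
absDiff-comm a b = +-comm (a ∸ b) (b ∸ a)

absDiff-shift : ∀ d a → absDiff a (d + a) ≡ d
absDiff-shift d a = cong₂ _+_ (m≤n⇒m∸n≡0 (m≤n+m a d)) (m+n∸n≡m d a)

edgeTypeℕ-comm : ∀ n a b → edgeTypeℕ n a b ≡ edgeTypeℕ n b a
edgeTypeℕ-comm n a b = cong (λ d → d ⊓ (n ∸ d)) (absDiff-comm a b)

edgeTypeℕ-shift : ∀ {n d} a → d + d ≤ n → edgeTypeℕ n a (d + a) ≡ d
edgeTypeℕ-shift {n} {d} a d+d≤n = begin
  absDiff a (d + a) ⊓ (n ∸ absDiff a (d + a)) ≡⟨ cong (λ e → e ⊓ (n ∸ e)) (absDiff-shift d a) ⟩
  d ⊓ (n ∸ d)                                 ≡⟨ m≤n⇒m⊓n≡m (m+n≤o⇒m≤o∸n d d+d≤n) ⟩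
  d                                           ∎
  where open ≡-Reasoning

edgeTypeℕ-shift-complement : ∀ {n d} a → d + d ≤ n → edgeTypeℕ n a ((n ∸ d) + a) ≡ d
edgeTypeℕ-shift-complement {n} {d} a d+d≤n = begin
  edgeTypeℕ n a ((n ∸ d) + a)  ≡⟨ cong (λ e → e ⊓ (n ∸ e)) (absDiff-shift (n ∸ d) a) ⟩
  (n ∸ d) ⊓ (n ∸ (n ∸ d))      ≡⟨ cong ((n ∸ d) ⊓_) (m∸[m∸n]≡n (m+n≤o⇒n≤o d d+d≤n)) ⟩
  (n ∸ d) ⊓ d                  ≡⟨ m≥n⇒m⊓n≡n (m+n≤o⇒m≤o∸n d d+d≤n) ⟩
  d                            ∎
  where open ≡-Reasoning

edgeTypeℕ≡⇒shift : ∀ {n d a b} → a ≤ b → b ≤ n → edgeTypeℕ n a b ≡ d →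
                   b ≡ d + a ⊎ b ≡ (n ∸ d) + a
edgeTypeℕ≡⇒shift {n} {d} {a} {b} a≤b b≤n type≡d = by-min (⊓-sel gap (n ∸ gap))
  where
  open ≡-Reasoning
  gap : ℕ
  gap = b ∸ a
  gap-type≡d : gap ⊓ (n ∸ gap) ≡ d
  gap-type≡d = subst (λ e → e ⊓ (n ∸ e) ≡ d) (cong (_+ gap) (m≤n⇒m∸n≡0 a≤b)) type≡d
  b≡ : ∀ {e} → gap ≡ e → b ≡ e + a
  b≡ refl = sym (m∸n+n≡m a≤b)
  by-min : gap ⊓ (n ∸ gap) ≡ gap ⊎ gap ⊓ (n ∸ gap) ≡ n ∸ gap →
           b ≡ d + a ⊎ b ≡ (n ∸ d) + a
  by-min (inj₁ min≡gap) = inj₁ (b≡ (trans (sym min≡gap) gap-type≡d))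
  by-min (inj₂ min≡co)  = inj₂ (b≡ (begin
    gap            ≡⟨ sym (m∸[m∸n]≡n (≤-trans (m∸n≤m b a) b≤n)) ⟩
    n ∸ (n ∸ gap)  ≡⟨ cong (n ∸_) (trans (sym min≡co) gap-type≡d) ⟩
    n ∸ d          ∎))

module _ {n : ℕ} where

  fromℕs : ∀ {xs} → All (_< n) xs → List (Fin n)
  fromℕs []           = []
  fromℕs (v<n ∷ v<ns) = fromℕ< v<n ∷ fromℕs v<ns

  map-toℕ-fromℕs : ∀ {xs} (v<ns : All (_< n) xs) → map toℕ (fromℕs v<ns) ≡ xs
  map-toℕ-fromℕs []           = refl
  map-toℕ-fromℕs (v<n ∷ v<ns) = cong₂ _∷_ (toℕ-fromℕ< v<n) (map-toℕ-fromℕs v<ns)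

  toPath : ∀ {xs} → All (_< n) xs → Unique xs → Path n
  toPath v<ns xs-unique =
    mkPath (fromℕs v<ns) (Unique.map⁻ (subst Unique (sym (map-toℕ-fromℕs v<ns)) xs-unique))

  module _ {xs} (v<ns : All (_< n) xs) (xs-unique : Unique xs) (u v : Fin n) where

    EdgeOf-toPath⁺ : Adjacent (toℕ u) (toℕ v) xs → EdgeOf u v (toPath v<ns xs-unique)
    EdgeOf-toPath⁺ adj =
      Adjacent-map⁻ toℕ-injective (subst (Adjacent (toℕ u) (toℕ v)) (sym (map-toℕ-fromℕs v<ns)) adj)

    EdgeOf-toPath⁻ : EdgeOf u v (toPath v<ns xs-unique) → Adjacent (toℕ u) (toℕ v) xs
    EdgeOf-toPath⁻ edge =
      subst (Adjacent (toℕ u) (toℕ v)) (map-toℕ-fromℕs v<ns) (Adjacent-map toℕ edge)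

TwoPathCover : ℕ → ℕ → Set
TwoPathCover n x = Σ (Path n) λ Q → Σ (Path n) λ Q′ →
  ((u v : Fin n) → edgeType n u v ≡ x → EdgeOf u v Q ⊎ EdgeOf u v Q′)
  × ((u v : Fin n) → EdgeOf u v Q ⊎ EdgeOf u v Q′ → edgeType n u v ≡ 1 ⊎ edgeType n u v ≡ x)

m≤n/o⇒m*o≤n : ∀ {m n} o .{{_ : NonZero o}} → m ≤ n / o → m * o ≤ n
m≤n/o⇒m*o≤n {n = n} o m≤n/o = ≤-trans (*-monoˡ-≤ o m≤n/o) (m/n*n≤m n o)

m*o≤n⇒m≤n/o : ∀ {m n} o .{{_ : NonZero o}} → m * o ≤ n → m ≤ n / o
m*o≤n⇒m≤n/o {m} {n} o m*o≤n = subst (_≤ n / o) (m*n/n≡m m o) (/-monoˡ-≤ o m*o≤n)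

parity-suc : ∀ k → parity (suc k) ≡ parity k ⁻¹
parity-suc k = sym (ℙ.⁻¹-selfInverse (ℙ.suc-homo-⁻¹ k))

parity-odd : ∀ k → parity (k + suc k) ≡ 1ℙ
parity-odd k = begin
  parity (k + suc k)               ≡⟨ ℙ.+-homo-+ k (suc k) ⟩
  parity k ℙ+ parity (suc k)       ≡⟨ cong (parity k ℙ+_) (parity-suc k) ⟩
  parity k ℙ+ parity k ⁻¹          ≡⟨ ℙ.p+p⁻¹≡1ℙ (parity k) ⟩
  1ℙ                               ∎
  where open ≡-Reasoning

module ZigzagCover (x ρ p : ℕ) (ρ<x : ρ < x) (1≤p : 1 ≤ p) where

  n m : ℕ
  n = ρ + suc p * x
  m = n ∸ x

  0<x : 0 < x
  0<x = ≤-<-trans z≤n ρ<x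

  instance
    x≢0 : NonZero x
    x≢0 = >-nonZero 0<x

  x+x≤n : x + x ≤ n
  x+x≤n = begin
    x + x            ≤⟨ +-monoʳ-≤ x (m≤n*m x p {{>-nonZero 1≤p}}) ⟩
    x + p * x        ≤⟨ m≤n+m (suc p * x) ρ ⟩
    n                ∎
    where open ≤-Reasoning

  x≤m : x ≤ m
  x≤m = m+n≤o⇒m≤o∸n x x+x≤n

  m+x≡n : m + x ≡ n
  m+x≡n = m∸n+n≡m (m+n≤o⇒n≤o x x+x≤n)

  instance
    m≢0 : NonZero m
    m≢0 = >-nonZero (<-≤-trans 0<x x≤m)

  Allowed : ℕ → ℕ → Set
  Allowed a b = edgeTypeℕ n a b ≡ 1 ⊎ edgeTypeℕ n a b ≡ x

  Allowed-sym : Symmetric Allowed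
  Allowed-sym {a} {b} = subst (λ t → t ≡ 1 ⊎ t ≡ x) (edgeTypeℕ-comm n a b)

  allowed-suc : ∀ a → Allowed a (suc a)
  allowed-suc a = inj₁ (edgeTypeℕ-shift a (≤-trans (+-mono-≤ 0<x 0<x) x+x≤n))

  allowed-+x : ∀ a → Allowed a (x + a)
  allowed-+x a = inj₂ (edgeTypeℕ-shift a x+x≤n)

  allowed-+m : ∀ a → Allowed a (m + a)
  allowed-+m a = inj₂ (edgeTypeℕ-shift-complement a x+x≤n)

  vertex : ℕ → ℕ → ℕ
  vertex c j = j * x + c

  vertex-sucʳ : ∀ c j → vertex c (suc j) ≡ x + vertex c j
  vertex-sucʳ c j = +-assoc x (j * x) c

  vertex-sucˡ : ∀ c j → vertex (suc c) j ≡ suc (vertex c j)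
  vertex-sucˡ c j = +-suc (j * x) c

  vertex-injective : ∀ c {i j} → vertex c i ≡ vertex c j → i ≡ j
  vertex-injective c {i} {j} eq = *-cancelʳ-≡ i j x (+-cancelʳ-≡ c (i * x) (j * x) eq)

  vertex-% : ∀ {c} j → c < x → vertex c j % x ≡ c
  vertex-% {c} j c<x = begin
    (j * x + c) % x  ≡⟨ cong (_% x) (+-comm (j * x) c) ⟩
    (c + j * x) % x  ≡⟨ [m+kn]%n≡m%n c j x ⟩
    c % x            ≡⟨ m<n⇒m%n≡m c<x ⟩
    c                ∎
    where open ≡-Reasoning

  vertex-%-/ : ∀ a → vertex (a % x) (a / x) ≡ a
  vertex-%-/ a = trans (+-comm (a / x * x) (a % x)) (sym (m≡m%n+[m/n]*n a x))

  top : ℕ → ℕ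
  top c with c <? ρ
  ... | yes _ = suc p
  ... | no  _ = p

  vertex<n : ∀ {c j} → c < x → j ≤ top c → vertex c j < n
  vertex<n {c} {j} c<x j≤top with c <? ρ
  ... | yes c<ρ = begin-strict
    j * x + c        ≤⟨ +-monoˡ-≤ c (*-monoˡ-≤ x j≤top) ⟩
    suc p * x + c    <⟨ +-monoʳ-< (suc p * x) c<ρ ⟩
    suc p * x + ρ    ≡⟨ +-comm (suc p * x) ρ ⟩
    n                ∎
    where open ≤-Reasoning
  ... | no _ = begin-strict
    j * x + c        ≤⟨ +-monoˡ-≤ c (*-monoˡ-≤ x j≤top) ⟩
    p * x + c        <⟨ +-monoʳ-< (p * x) c<x ⟩
    p * x + x        ≡⟨ +-comm (p * x) x ⟩
    suc p * x        ≤⟨ m≤n+m (suc p * x) ρ ⟩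
    n                ∎
    where open ≤-Reasoning

  top<⇒n≤vertex : ∀ {c j} → top c < j → n ≤ vertex c j
  top<⇒n≤vertex {c} {j} top<j with c <? ρ
  ... | yes _ = begin
    ρ + suc p * x        ≤⟨ +-monoˡ-≤ (suc p * x) (<⇒≤ ρ<x) ⟩
    suc (suc p) * x      ≤⟨ *-monoˡ-≤ x top<j ⟩
    j * x                ≤⟨ m≤m+n (j * x) c ⟩
    j * x + c            ∎
    where open ≤-Reasoning
  ... | no ¬c<ρ = begin
    ρ + suc p * x        ≤⟨ +-mono-≤ (≮⇒≥ ¬c<ρ) (*-monoˡ-≤ x top<j) ⟩
    c + j * x            ≡⟨ +-comm c (j * x) ⟩
    j * x + c            ∎
    where open ≤-Reasoning

  vertex<n⇒≤top : ∀ {c j} → vertex c j < n → j ≤ top c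
  vertex<n⇒≤top v<n = ≮⇒≥ (λ top<j → <⇒≱ v<n (top<⇒n≤vertex top<j))

  top-suc : ∀ {c} → suc c ≢ ρ → top (suc c) ≡ top c
  top-suc {c} sc≢ρ with c <? ρ | suc c <? ρ
  ... | yes _   | yes _    = refl
  ... | no  _   | no  _    = refl
  ... | yes c<ρ | no sc≮ρ  = ⊥-elim (sc≮ρ (≤∧≢⇒< c<ρ sc≢ρ))
  ... | no c≮ρ  | yes sc<ρ = ⊥-elim (c≮ρ (<-trans (n<1+n c) sc<ρ))

  column : Parity → ℕ → List ℕ
  column 0ℙ c = applyUpTo (vertex c) (suc (top c))
  column 1ℙ c = applyDownFrom (vertex c) (suc (top c))

  column-nonempty : ∀ π c → column π c ≢ []
  column-nonempty 0ℙ c ()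
  column-nonempty 1ℙ c ()

  column-all : ∀ {P : ℕ → Set} π c → (∀ {j} → j ≤ top c → P (vertex c j)) → All P (column π c)
  column-all 0ℙ c P-vertex = All.applyUpTo⁺₁ (vertex c) _ (P-vertex ∘ s≤s⁻¹)
  column-all 1ℙ c P-vertex = All.applyDownFrom⁺₁ (vertex c) _ (P-vertex ∘ s≤s⁻¹)

  column-unique : ∀ π c → Unique (column π c)
  column-unique 0ℙ c = Unique.applyUpTo⁺₁ (vertex c) _ (λ i<j _ → <⇒≢ i<j ∘ vertex-injective c)
  column-unique 1ℙ c = Unique.applyDownFrom⁺₁ (vertex c) _ (λ j<i _ → >⇒≢ j<i ∘ vertex-injective c)

  allowed-step : ∀ c j → Allowed (vertex c j) (vertex c (suc j))
  allowed-step c j = subst (Allowed (vertex c j)) (sym (vertex-sucʳ c j)) (allowed-+x (vertex c j))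

  column-linked : ∀ π c → Linked Allowed (column π c)
  column-linked 0ℙ c = Linked.applyUpTo⁺₂ (vertex c) _ (allowed-step c)
  column-linked 1ℙ c = Linked.applyDownFrom⁺₂ (vertex c) _
    (λ j → Allowed-sym {vertex c j} (allowed-step c j))

  column-step : ∀ π {c j} → suc j ≤ top c → Adjacent (vertex c j) (vertex c (suc j)) (column π c)
  column-step 0ℙ {c} sj≤top = inj₁ (Consec-applyUpTo (vertex c) (s≤s sj≤top))
  column-step 1ℙ {c} sj≤top = inj₂ (Consec-applyDownFrom (vertex c) (s≤s sj≤top))

  columns-joined : ∀ π c → (π ≡ 0ℙ → suc c ≢ ρ) →
                   Connected Allowed (last (column π c)) (head (column (π ⁻¹) (suc c)))
  columns-joined 0ℙ c sc≢ρ
    rewrite last-applyUpTo (vertex c) (top c) | top-suc (sc≢ρ refl) | vertex-sucˡ c (top c) =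
    just (allowed-suc (vertex c (top c)))
  columns-joined 1ℙ c _ rewrite last-applyDownFrom (vertex c) (top c) = just (allowed-suc c)

  parity-even⇒suc≢ρ : ∀ {c} → parity (c + ρ) ≡ 0ℙ → suc c ≢ ρ
  parity-even⇒suc≢ρ {c} even sc≡ρ =
    ℙ.p≢p⁻¹ 0ℙ (trans (sym even) (subst (λ r → parity (c + r) ≡ 1ℙ) sc≡ρ (parity-odd c)))

  zigzagColumn : ℕ → List ℕ
  zigzagColumn c = column (parity (c + ρ)) c

  Q : List ℕ
  Q = concat (applyUpTo zigzagColumn x)

  Q-linked : Linked Allowed Q
  Q-linked = Linked-concat
    (All.applyUpTo⁺₂ zigzagColumn x (λ c → column-linked (parity (c + ρ)) c))
    (All.applyUpTo⁺₂ zigzagColumn x (λ c → column-nonempty (parity (c + ρ)) c))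
    (Linked.applyUpTo⁺₂ zigzagColumn x joined)
    where
    joined : ∀ c → Connected Allowed (last (zigzagColumn c)) (head (zigzagColumn (suc c)))
    joined c rewrite parity-suc (c + ρ) = columns-joined (parity (c + ρ)) c parity-even⇒suc≢ρ

  zigzagColumn-residues : ∀ {c} → c < x → All (λ v → v % x ≡ c) (zigzagColumn c)
  zigzagColumn-residues {c} c<x = column-all (parity (c + ρ)) c (λ {j} _ → vertex-% j c<x)

  Q-unique : Unique Q
  Q-unique = Unique.concat⁺
    (All.applyUpTo⁺₂ zigzagColumn x (λ c → column-unique (parity (c + ρ)) c))
    (AllPairs.applyUpTo⁺₁ zigzagColumn x λ i<j j<x →
      Disjoint-byKey (_% x) (zigzagColumn-residues (<-trans i<j j<x)) (zigzagColumn-residues j<x) (<⇒≢ i<j))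

  Q-bounded : All (_< n) Q
  Q-bounded = All.concat⁺ (All.applyUpTo⁺₁ zigzagColumn x
    (λ {c} c<x → column-all (parity (c + ρ)) c (vertex<n c<x)))

  Q-covers : ∀ a → x + a < n → Adjacent a (x + a) Q
  Q-covers a x+a<n = subst₂ (λ s t → Adjacent s t Q) (vertex-%-/ a) shifted
    (Adjacent-concat (column-step (parity (a % x + ρ)) {j = a / x}
                        (vertex<n⇒≤top (subst (_< n) (sym shifted) x+a<n)))
                     (∈-applyUpTo⁺ zigzagColumn (m%n<n a x)))
    where
    shifted : vertex (a % x) (suc (a / x)) ≡ x + a
    shifted = trans (vertex-sucʳ (a % x) (a / x)) (cong (x +_) (vertex-%-/ a))

  rung : Parity → ℕ → List ℕ
  rung 0ℙ i = i ∷ m + i ∷ []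
  rung 1ℙ i = m + i ∷ i ∷ []

  rung-nonempty : ∀ π i → rung π i ≢ []
  rung-nonempty 0ℙ i ()
  rung-nonempty 1ℙ i ()

  rung-all : ∀ {P : ℕ → Set} π {i} → P i → P (m + i) → All P (rung π i)
  rung-all 0ℙ P-i P-m+i = P-i ∷ P-m+i ∷ []
  rung-all 1ℙ P-i P-m+i = P-m+i ∷ P-i ∷ []

  rung-unique : ∀ π i → Unique (rung π i)
  rung-unique 0ℙ i = (<⇒≢ (m<n+m i (>-nonZero⁻¹ m)) ∷ []) ∷ [] ∷ []
  rung-unique 1ℙ i = (>⇒≢ (m<n+m i (>-nonZero⁻¹ m)) ∷ []) ∷ [] ∷ []

  rung-linked : ∀ π i → Linked Allowed (rung π i)
  rung-linked 0ℙ i = allowed-+m i ∷ [-]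
  rung-linked 1ℙ i = Allowed-sym {i} (allowed-+m i) ∷ [-]

  rungs-joined : ∀ π i → Connected Allowed (last (rung π i)) (head (rung (π ⁻¹) (suc i)))
  rungs-joined 0ℙ i = just (subst (Allowed (m + i)) (sym (+-suc m i)) (allowed-suc (m + i)))
  rungs-joined 1ℙ i = just (allowed-suc i)

  rung-ends : ∀ π i → Adjacent i (m + i) (rung π i)
  rung-ends 0ℙ i = inj₁ here
  rung-ends 1ℙ i = inj₂ here

  zigzagRung : ℕ → List ℕ
  zigzagRung i = rung (parity i) i

  Q′ : List ℕ
  Q′ = concat (applyUpTo zigzagRung x)

  Q′-linked : Linked Allowed Q′
  Q′-linked = Linked-concat
    (All.applyUpTo⁺₂ zigzagRung x (λ i → rung-linked (parity i) i))
    (All.applyUpTo⁺₂ zigzagRung x (λ i → rung-nonempty (parity i) i))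
    (Linked.applyUpTo⁺₂ zigzagRung x joined)
    where
    joined : ∀ i → Connected Allowed (last (zigzagRung i)) (head (zigzagRung (suc i)))
    joined i rewrite parity-suc i = rungs-joined (parity i) i

  zigzagRung-residues : ∀ {i} → i < x → All (λ v → v % m ≡ i) (zigzagRung i)
  zigzagRung-residues {i} i<x =
    rung-all (parity i) i%m≡i (trans (cong (_% m) (+-comm m i)) (trans ([m+n]%n≡m%n i m) i%m≡i))
    where
    i%m≡i : i % m ≡ i
    i%m≡i = m<n⇒m%n≡m (<-≤-trans i<x x≤m)

  Q′-unique : Unique Q′
  Q′-unique = Unique.concat⁺
    (All.applyUpTo⁺₂ zigzagRung x (λ i → rung-unique (parity i) i))
    (AllPairs.applyUpTo⁺₁ zigzagRung x λ i<j j<x →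
      Disjoint-byKey (_% m) (zigzagRung-residues (<-trans i<j j<x)) (zigzagRung-residues j<x) (<⇒≢ i<j))

  Q′-bounded : All (_< n) Q′
  Q′-bounded = All.concat⁺ (All.applyUpTo⁺₁ zigzagRung x (λ {i} i<x → rung-all (parity i)
    (<-≤-trans i<x (m+n≤o⇒n≤o x x+x≤n)) (subst (m + i <_) m+x≡n (+-monoʳ-< m i<x))))

  Q′-covers : ∀ a → a < x → Adjacent a (m + a) Q′
  Q′-covers a a<x = Adjacent-concat (rung-ends (parity a) a) (∈-applyUpTo⁺ zigzagRung a<x)

  x-edges-covered-≤ : ∀ {a b} → a ≤ b → b < n → edgeTypeℕ n a b ≡ x →
                      Adjacent a b Q ⊎ Adjacent a b Q′
  x-edges-covered-≤ {a} a≤b b<n type≡x with edgeTypeℕ≡⇒shift a≤b (<⇒≤ b<n) type≡x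
  ... | inj₁ refl = inj₁ (Q-covers a b<n)
  ... | inj₂ refl = inj₂ (Q′-covers a (+-cancelˡ-< m a x (subst (m + a <_) (sym m+x≡n) b<n)))

  x-edges-covered : ∀ {a b} → a < n → b < n → edgeTypeℕ n a b ≡ x →
                    Adjacent a b Q ⊎ Adjacent a b Q′
  x-edges-covered {a} {b} a<n b<n type≡x with ≤-total a b
  ... | inj₁ a≤b = x-edges-covered-≤ a≤b b<n type≡x
  ... | inj₂ b≤a = ⊎-map Adjacent-sym Adjacent-sym
    (x-edges-covered-≤ b≤a a<n (trans (edgeTypeℕ-comm n b a) type≡x))

  twoPathCover : TwoPathCover n x
  twoPathCover = Qₚ , Q′ₚ , covers , allowed
    where
    Qₚ Q′ₚ : Path n
    Qₚ  = toPath Q-bounded Q-unique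
    Q′ₚ = toPath Q′-bounded Q′-unique
    covers : (u v : Fin n) → edgeType n u v ≡ x → EdgeOf u v Qₚ ⊎ EdgeOf u v Q′ₚ
    covers u v type≡x =
      ⊎-map (EdgeOf-toPath⁺ Q-bounded Q-unique u v) (EdgeOf-toPath⁺ Q′-bounded Q′-unique u v)
            (x-edges-covered (toℕ<n u) (toℕ<n v) type≡x)
    allowed : (u v : Fin n) → EdgeOf u v Qₚ ⊎ EdgeOf u v Q′ₚ → Allowed (toℕ u) (toℕ v)
    allowed u v (inj₁ edge) =
      Linked-Adjacent (λ {a} → Allowed-sym {a}) Q-linked (EdgeOf-toPath⁻ Q-bounded Q-unique u v edge)
    allowed u v (inj₂ edge) =
      Linked-Adjacent (λ {a} → Allowed-sym {a}) Q′-linked (EdgeOf-toPath⁻ Q′-bounded Q′-unique u v edge)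

lemma3p10 : (n x : ℕ) → 1 ≤ x → x ≤ n / 2 →
    Σ (Path n) λ Q → Σ (Path n) λ Q′ →
      ((u v : Fin n) → edgeType n u v ≡ x → EdgeOf u v Q ⊎ EdgeOf u v Q′)
      × ((u v : Fin n) → EdgeOf u v Q ⊎ EdgeOf u v Q′ →
           edgeType n u v ≡ 1 ⊎ edgeType n u v ≡ x)
lemma3p10 n x 1≤x x≤n/2 = cover (n / x) (m≡m%n+[m/n]*n n x) 2≤n/x
  where
  instance
    x≢0 : NonZero x
    x≢0 = >-nonZero 1≤x

  2≤n/x : 2 ≤ n / x
  2≤n/x = m*o≤n⇒m≤n/o x (subst (_≤ n) (*-comm x 2) (m≤n/o⇒m*o≤n 2 x≤n/2))

  cover : ∀ q → n ≡ n % x + q * x → 2 ≤ q → TwoPathCover n x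
  cover (suc p) n≡ (s≤s 1≤p) =
    subst (λ k → TwoPathCover k x) (sym n≡) (ZigzagCover.twoPathCover x (n % x) p (m%n<n n x) 1≤p)
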